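{- There is an interpretation $(\mathcal{M}_{IPC},\varepsilon)$ such that for all $\varphi,\psi\in Fm_0$: $(\mathcal{M}_{IPC},\varepsilon)\vDash\varphi\equiv\psi\iff\ \vdash_{IPC}\varphi\leftrightarrow\psi$.
   Context: $Fm$ is the set of formulas generated from an infinite set $V$ of propositional variables by $\bot$, binary $\rightarrow,\vee,\wedge$ and unary $\square$; $Fm_0$ is the set of formulas without $\square$. Abbreviations: $\varphi\leftrightarrow\psi:=(\varphi\rightarrow\psi)\wedge(\psi\rightarrow\varphi)$, $\varphi\equiv\psi:=\square(\varphi\rightarrow\psi)\wedge\square(\psi\rightarrow\varphi)$. $\vdash_{IPC}$ denotes provability in intuitionistic propositional logic. Semantics: a Heyting algebra $(M,f_\top,f_\bot,f_\vee,f_\wedge,f_\rightarrow)$ is a bounded lattice (top $f_\top$, bottom $f_\bot$, order $\le$) with $f_\rightarrow(m,m')$ the greatest $m''$ with $f_\wedge(m,m'')\le m'$; a filter is a non-empty upward closed $F\subseteq M$ closed under $f_\wedge$ with $f_\bot\notin F$; an ultrafilter is a maximal filter. A model $\mathcal{M}=(M,\mathit{TRUE},f_\top,f_\bot,f_\rightarrow,f_\vee,f_\wedge,f_\square)$ is a Heyting algebra with an ultrafilter $\mathit{TRUE}$ and unary $f_\square$ such that for all $m,m',m''$: (1) $f_\square(m)\le m$; (2) $f_\square(f_\rightarrow(m,m'))\le f_\rightarrow(f_\square(f_\rightarrow(m',m'')),f_\square(f_\rightarrow(m,m'')))$; (3) $f_\square(f_\vee(m,m'))\le f_\vee(f_\square(m),f_\square(m'))$;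 (4) $f_\square(m)\in\mathit{TRUE}\iff m=f_\top$. An assignment $\varepsilon:V\to M$ extends homomorphically to $Fm$ ($\varepsilon(\bot)=f_\bot$, $\varepsilon(\square\varphi)=f_\square(\varepsilon(\varphi))$, $\varepsilon(\varphi*\psi)=f_*(\varepsilon(\varphi),\varepsilon(\psi))$). An interpretation is a pair $(\mathcal{M},\varepsilon)$; $(\mathcal{M},\varepsilon)\vDash\varphi$ iff $\varepsilon(\varphi)\in\mathit{TRUE}$. -}

module Defs where

open import Level using (Level; _⊔_; suc; 0ℓ)
open import Data.Nat using (ℕ)
open import Data.Product using (Σ; _×_; ∃)
open import Relation.Nullary using (¬_)
open import Relation.Unary using (Pred; _∈_; _⊆_)
open import Relation.Binary.Lattice.Bundles using (HeytingAlgebra)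
open import Function.Bundles using (_⇔_)

Var : Set
Var = ℕ

data Fm : Set where
  var  : Var → Fm
  ⊥'   : Fm
  _⇒_  : Fm → Fm → Fm
  _∨'_ : Fm → Fm → Fm
  _∧'_ : Fm → Fm → Fm
  □_   : Fm → Fm

infixr 5 _⇒_
infixr 6 _∨'_
infixr 7 _∧'_
infix  8 □_

data Fm₀ : Set where
  var  : Var → Fm₀
  ⊥'   : Fm₀
  _⇒_  : Fm₀ → Fm₀ → Fm₀
  _∨'_ : Fm₀ → Fm₀ → Fm₀
  _∧'_ : Fm₀ → Fm₀ → Fm₀

⌜_⌝ : Fm₀ → Fm
⌜ var x ⌝  = var x
⌜ ⊥' ⌝     = ⊥'
⌜ φ ⇒ ψ ⌝  = ⌜ φ ⌝ ⇒ ⌜ ψ ⌝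
⌜ φ ∨' ψ ⌝ = ⌜ φ ⌝ ∨' ⌜ ψ ⌝
⌜ φ ∧' ψ ⌝ = ⌜ φ ⌝ ∧' ⌜ ψ ⌝

_⇔'_ : Fm₀ → Fm₀ → Fm₀
φ ⇔' ψ = (φ ⇒ ψ) ∧' (ψ ⇒ φ)

_≡'_ : Fm → Fm → Fm
φ ≡' ψ = (□ (φ ⇒ ψ)) ∧' (□ (ψ ⇒ φ))

data ⊢IPC_ : Fm₀ → Set where
  ax-K   : ∀ {φ ψ} → ⊢IPC (φ ⇒ (ψ ⇒ φ))
  ax-S   : ∀ {φ ψ χ} → ⊢IPC ((φ ⇒ (ψ ⇒ χ)) ⇒ ((φ ⇒ ψ) ⇒ (φ ⇒ χ)))
  ax-∧I  : ∀ {φ ψ} → ⊢IPC (φ ⇒ (ψ ⇒ (φ ∧' ψ)))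
  ax-∧E₁ : ∀ {φ ψ} → ⊢IPC ((φ ∧' ψ) ⇒ φ)
  ax-∧E₂ : ∀ {φ ψ} → ⊢IPC ((φ ∧' ψ) ⇒ ψ)
  ax-∨I₁ : ∀ {φ ψ} → ⊢IPC (φ ⇒ (φ ∨' ψ))
  ax-∨I₂ : ∀ {φ ψ} → ⊢IPC (ψ ⇒ (φ ∨' ψ))
  ax-∨E  : ∀ {φ ψ χ} → ⊢IPC ((φ ⇒ χ) ⇒ ((ψ ⇒ χ) ⇒ ((φ ∨' ψ) ⇒ χ)))
  ax-⊥E  : ∀ {φ} → ⊢IPC (⊥' ⇒ φ)
  mp     : ∀ {φ ψ} → ⊢IPC (φ ⇒ ψ) → ⊢IPC φ → ⊢IPC ψ

module _ {c ℓ₁ ℓ₂ : Level} (H : HeytingAlgebra c ℓ₁ ℓ₂) where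
  open HeytingAlgebra H

  record IsFilter {ℓ : Level} (F : Pred Carrier ℓ) : Set (c ⊔ ℓ₂ ⊔ ℓ) where
    field
      nonempty   : ∃ λ m → m ∈ F
      upward     : ∀ {m m'} → m ∈ F → m ≤ m' → m' ∈ F
      ∧-closed   : ∀ {m m'} → m ∈ F → m' ∈ F → (m ∧ m') ∈ F
      proper     : ¬ (⊥ ∈ F)

  record IsUltrafilter {ℓ : Level} (F : Pred Carrier ℓ) : Set (c ⊔ ℓ₂ ⊔ suc ℓ) where
    field
      isFilter : IsFilter F
      maximal  : ∀ (G : Pred Carrier ℓ) → IsFilter G → F ⊆ G → G ⊆ F

record Model (c ℓ₁ ℓ₂ ℓ : Level) : Set (suc (c ⊔ ℓ₁ ⊔ ℓ₂ ⊔ ℓ)) where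
  field
    algebra : HeytingAlgebra c ℓ₁ ℓ₂
  open HeytingAlgebra algebra public
  field
    TRUE          : Pred Carrier ℓ
    isUltrafilter : IsUltrafilter algebra TRUE
    f□            : Carrier → Carrier
    f□-cong       : ∀ {m m'} → m ≈ m' → f□ m ≈ f□ m'
    ax1 : ∀ m → f□ m ≤ m
    ax2 : ∀ m m' m'' → f□ (m ⇨ m') ≤ (f□ (m' ⇨ m'') ⇨ f□ (m ⇨ m''))
    ax3 : ∀ m m' → f□ (m ∨ m') ≤ (f□ m ∨ f□ m')
    ax4 : ∀ m → (f□ m ∈ TRUE) ⇔ (m ≈ ⊤)

module _ {c ℓ₁ ℓ₂ ℓ : Level} (𝓜 : Model c ℓ₁ ℓ₂ ℓ) where
  open Model 𝓜

  Assignment : Set c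
  Assignment = Var → Carrier

  ⟦_⟧ : Fm → Assignment → Carrier
  ⟦ var x ⟧ ε  = ε x
  ⟦ ⊥' ⟧ ε     = ⊥
  ⟦ φ ⇒ ψ ⟧ ε  = ⟦ φ ⟧ ε ⇨ ⟦ ψ ⟧ ε
  ⟦ φ ∨' ψ ⟧ ε = ⟦ φ ⟧ ε ∨ ⟦ ψ ⟧ ε
  ⟦ φ ∧' ψ ⟧ ε = ⟦ φ ⟧ ε ∧ ⟦ ψ ⟧ ε
  ⟦ □ φ ⟧ ε    = f□ (⟦ φ ⟧ ε)

  _⊨_ : Assignment → Fm → Set ℓ
  ε ⊨ φ = ⟦ φ ⟧ ε ∈ TRUE

-- M_IPC is the Lindenbaum algebra of IPC.  TRUE is the ultrafilter of formulas that are
-- classically true when every variable is true, and □a is ⊤ if ⊢ a and ⊥ otherwise, so that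
-- TRUE(□a) holds exactly when a is provable; axioms (1), (2) and (4) are then immediate and
-- axiom (3) is the disjunction property of IPC, obtained by gluing two Kripke countermodels
-- under a new root.
--
-- For □ to be a function, provability must be decided.  Natural deduction restricted to
-- sequents over the subformulas of a formula is a monotone operator on a finite set, so its
-- least fixed point is computable by iteration; it is sound for IPC, and a sequent outside it
-- extends to a saturated prime set of subformulas, i.e. a world of the finite canonical
-- Kripke model, that refutes it.

module Submission where

open import Defs
open import Level using (0ℓ)
open import Data.Nat using (ℕ)
open import Data.Fin using (Fin)
open import Data.Product using (Σ; _×_; _,_; ∃₂)
open import Function.Bundles using (_⇔_)
open import Relation.Binary.PropositionalEquality using (_≡_)

module Derivations where

  open import Data.Empty using () renaming (⊥ to Empty)
  open import Data.Sum using (_⊎_; inj₁; inj₂)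
  open import Relation.Binary.PropositionalEquality using (refl)

  Hyps : Set₁
  Hyps = Fm₀ → Set

  ∅ : Hyps
  ∅ _ = Empty

  infixl 4 _▸_
  _▸_ : Hyps → Fm₀ → Hyps
  (Γ ▸ A) B = B ≡ A ⊎ Γ B

  infix 3 _⊢_
  data _⊢_ (Γ : Hyps) : Fm₀ → Set where
    hyp : ∀ {A} → Γ A → Γ ⊢ A
    ax  : ∀ {A} → ⊢IPC A → Γ ⊢ A
    mp  : ∀ {A B} → Γ ⊢ A ⇒ B → Γ ⊢ A → Γ ⊢ B

  private
    variable
      Γ Δ : Hyps
      A B C : Fm₀

  ⇒-refl : ⊢IPC (A ⇒ A)
  ⇒-refl {A} = mp (mp (ax-S {A} {A ⇒ A}) ax-K) (ax-K {A} {A})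

  deduction : Γ ▸ A ⊢ B → Γ ⊢ A ⇒ B
  deduction (hyp (inj₁ refl)) = ax ⇒-refl
  deduction (hyp (inj₂ p))    = mp (ax ax-K) (hyp p)
  deduction (ax p)            = mp (ax ax-K) (ax p)
  deduction (mp d e)          = mp (mp (ax ax-S) (deduction d)) (deduction e)

  weaken : (∀ {A} → Γ A → Δ A) → Γ ⊢ A → Δ ⊢ A
  weaken Γ⊆Δ (hyp p)  = hyp (Γ⊆Δ p)
  weaken Γ⊆Δ (ax p)   = ax p
  weaken Γ⊆Δ (mp d e) = mp (weaken Γ⊆Δ d) (weaken Γ⊆Δ e)

  ∅⊢⇒⊢IPC : ∅ ⊢ A → ⊢IPC A
  ∅⊢⇒⊢IPC (ax p)   = p
  ∅⊢⇒⊢IPC (mp d e) = mp (∅⊢⇒⊢IPC d) (∅⊢⇒⊢IPC e)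

  deduction₀ : ∅ ▸ A ⊢ B → ⊢IPC (A ⇒ B)
  deduction₀ d = ∅⊢⇒⊢IPC (deduction d)

  assumption : Γ ▸ A ⊢ A
  assumption = hyp (inj₁ refl)

  weaken₁ : Γ ⊢ A → Γ ▸ B ⊢ A
  weaken₁ = weaken inj₂

  by : ⊢IPC (A ⇒ B) → Γ ⊢ A → Γ ⊢ B
  by p d = mp (ax p) d

  cut : Γ ⊢ A → Γ ▸ A ⊢ B → Γ ⊢ B
  cut d e = mp (deduction e) d

  ∧-intro : Γ ⊢ A → Γ ⊢ B → Γ ⊢ A ∧' B
  ∧-intro d e = mp (by ax-∧I d) e

  ∨-elim : Γ ⊢ A ∨' B → Γ ▸ A ⊢ C → Γ ▸ B ⊢ C → Γ ⊢ C
  ∨-elim d e f = mp (mp (by ax-∨E (deduction e)) (deduction f)) d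

module KripkeSemantics where

  open import Data.Empty using () renaming (⊥ to Empty)
  open import Data.Product using (proj₁; proj₂; ∃)
  open import Data.Sum using (_⊎_; inj₁; inj₂)
  open import Relation.Nullary using (¬_)
  open import Relation.Binary.PropositionalEquality using (refl)

  record KripkeModel : Set₁ where
    field
      World   : Set
      _≼_     : World → World → Set
      ≼-refl  : ∀ {w} → w ≼ w
      ≼-trans : ∀ {u v w} → u ≼ v → v ≼ w → u ≼ w
      Val     : World → Var → Set
      Val-mono : ∀ {w v x} → w ≼ v → Val w x → Val v x

  module Forcing (K : KripkeModel) where
    open KripkeModel K

    infix 4 _⊩_
    _⊩_ : World → Fm₀ → Set
    w ⊩ var x    = Val w x
    w ⊩ ⊥'       = Empty
    w ⊩ (a ⇒ b)  = ∀ v → w ≼ v → v ⊩ a → v ⊩ b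
    w ⊩ (a ∨' b) = w ⊩ a ⊎ w ⊩ b
    w ⊩ (a ∧' b) = w ⊩ a × w ⊩ b

    ⊩-mono : ∀ {w v} a → w ≼ v → w ⊩ a → v ⊩ a
    ⊩-mono (var x)  w≼v p        = Val-mono w≼v p
    ⊩-mono (a ⇒ b)  w≼v f        = λ u v≼u → f u (≼-trans w≼v v≼u)
    ⊩-mono (a ∨' b) w≼v (inj₁ p) = inj₁ (⊩-mono a w≼v p)
    ⊩-mono (a ∨' b) w≼v (inj₂ q) = inj₂ (⊩-mono b w≼v q)
    ⊩-mono (a ∧' b) w≼v (p , q)  = ⊩-mono a w≼v p , ⊩-mono b w≼v q

    sound : ∀ {a} → ⊢IPC a → ∀ w → w ⊩ a
    sound (ax-K {φ}) w v _ p u v≼u _ = ⊩-mono φ v≼u p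
    sound ax-S w v _ f u v≼u g t u≼t p =
      f t (≼-trans v≼u u≼t) p t ≼-refl (g t u≼t p)
    sound (ax-∧I {φ}) w v _ p u v≼u q = ⊩-mono φ v≼u p , q
    sound ax-∧E₁ w v _ = proj₁
    sound ax-∧E₂ w v _ = proj₂
    sound ax-∨I₁ w v _ = inj₁
    sound ax-∨I₂ w v _ = inj₂
    sound ax-∨E w v _ f u v≼u g t u≼t (inj₁ p) = f t (≼-trans v≼u u≼t) p
    sound ax-∨E w v _ f u v≼u g t u≼t (inj₂ q) = g t u≼t q
    sound ax-⊥E w v _ ()
    sound (mp d e) w = sound d w w ≼-refl (sound e w)

  module _ (K L : KripkeModel) where
    private
      module K = KripkeModel K
      module L = KripkeModel L

    record BoundedMorphism : Set where
      field
        map      : K.World → L.World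
        map-mono : ∀ {w v} → w K.≼ v → map w L.≼ map v
        map-back : ∀ {w v′} → map w L.≼ v′ → ∃ λ v → w K.≼ v × map v ≡ v′
        map-val⁺ : ∀ {w x} → K.Val w x → L.Val (map w) x
        map-val⁻ : ∀ {w x} → L.Val (map w) x → K.Val w x

  module _ {K L : KripkeModel} (f : BoundedMorphism K L) where
    open BoundedMorphism f
    private
      module K = Forcing K
      module L = Forcing L

    ⊩-preserve : ∀ {w} a → w K.⊩ a → map w L.⊩ a
    ⊩-reflect  : ∀ {w} a → map w L.⊩ a → w K.⊩ a
    ⊩-preserve (var x)  p = map-val⁺ p
    ⊩-preserve (a ⇒ b)  g v′ w≼v′ p with map-back w≼v′
    ... | v , w≼v , refl = ⊩-preserve b (g v w≼v (⊩-reflect a p))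
    ⊩-preserve (a ∨' b) (inj₁ p) = inj₁ (⊩-preserve a p)
    ⊩-preserve (a ∨' b) (inj₂ q) = inj₂ (⊩-preserve b q)
    ⊩-preserve (a ∧' b) (p , q)  = ⊩-preserve a p , ⊩-preserve b q
    ⊩-reflect (var x)  p = map-val⁻ p
    ⊩-reflect (a ⇒ b)  g v w≼v p = ⊩-reflect b (g (map v) (map-mono w≼v) (⊩-preserve a p))
    ⊩-reflect (a ∨' b) (inj₁ p) = inj₁ (⊩-reflect a p)
    ⊩-reflect (a ∨' b) (inj₂ q) = inj₂ (⊩-reflect b q)
    ⊩-reflect (a ∧' b) (p , q)  = ⊩-reflect a p , ⊩-reflect b q

  CounterModel : Fm₀ → Set₁
  CounterModel a = Σ KripkeModel λ K → Σ (KripkeModel.World K) λ w → ¬ Forcing._⊩_ K w a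

  refute : ∀ {a} → CounterModel a → ¬ ⊢IPC a
  refute (K , w , w⊮a) d = w⊮a (Forcing.sound K d w)

  module Gluing (K₁ K₂ : KripkeModel) where
    private
      module K₁ = KripkeModel K₁
      module K₂ = KripkeModel K₂
    open import Data.Unit using (⊤; tt)

    data World : Set where
      root : World
      inl  : K₁.World → World
      inr  : K₂.World → World

    infix 4 _≼_
    _≼_ : World → World → Set
    root  ≼ _     = ⊤
    inl w ≼ inl v = w K₁.≼ v
    inr w ≼ inr v = w K₂.≼ v
    _     ≼ _     = Empty

    ≼-refl : ∀ {w} → w ≼ w
    ≼-refl {root}  = tt
    ≼-refl {inl w} = K₁.≼-refl
    ≼-refl {inr w} = K₂.≼-refl

    ≼-trans : ∀ {u v w} → u ≼ v → v ≼ w → u ≼ w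
    ≼-trans {root}                    _ _ = tt
    ≼-trans {inl _} {inl _} {inl _} p q = K₁.≼-trans p q
    ≼-trans {inr _} {inr _} {inr _} p q = K₂.≼-trans p q

    Val : World → Var → Set
    Val root    _ = Empty
    Val (inl w) x = K₁.Val w x
    Val (inr w) x = K₂.Val w x

    Val-mono : ∀ {w v x} → w ≼ v → Val w x → Val v x
    Val-mono {inl _} {inl _} = K₁.Val-mono
    Val-mono {inr _} {inr _} = K₂.Val-mono

    glued : KripkeModel
    glued = record
      { World    = World
      ; _≼_      = _≼_
      ; ≼-refl   = λ {w} → ≼-refl {w}
      ; ≼-trans  = λ {u} {v} {w} → ≼-trans {u} {v} {w}
      ; Val      = Val
      ; Val-mono = λ {w} {v} → Val-mono {w} {v} }

    inl-morphism : BoundedMorphism K₁ glued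
    inl-morphism = record
      { map = inl ; map-mono = λ p → p ; map-back = back ; map-val⁺ = λ p → p ; map-val⁻ = λ p → p }
      where
      back : ∀ {w v′} → inl w ≼ v′ → ∃ λ v → w K₁.≼ v × inl v ≡ v′
      back {v′ = inl v} w≼v = v , w≼v , refl

    inr-morphism : BoundedMorphism K₂ glued
    inr-morphism = record
      { map = inr ; map-mono = λ p → p ; map-back = back ; map-val⁺ = λ p → p ; map-val⁻ = λ p → p }
      where
      back : ∀ {w v′} → inr w ≼ v′ → ∃ λ v → w K₂.≼ v × inr v ≡ v′
      back {v′ = inr v} w≼v = v , w≼v , refl

  countermodel-∨ : ∀ {a b} → CounterModel a → CounterModel b → CounterModel (a ∨' b)
  countermodel-∨ {a} {b} (K₁ , w₁ , w₁⊮a) (K₂ , w₂ , w₂⊮b) = glued , root , root⊮a∨b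
    where
    open Gluing K₁ K₂
    open Forcing glued
    root⊮a∨b : ¬ root ⊩ a ∨' b
    root⊮a∨b (inj₁ p) = w₁⊮a (⊩-reflect inl-morphism a (⊩-mono a _ p))
    root⊮a∨b (inj₂ q) = w₂⊮b (⊩-reflect inr-morphism b (⊩-mono b _ q))

module FixedPoint where

  open import Data.Empty using () renaming (⊥ to Empty)
  open import Data.Nat using (zero; suc; _≤_; _<_; z≤n; s≤s)
  open import Data.Nat.Properties using (≤-trans; m≤n⇒m≤1+n; 1+n≰n)
  open import Data.List using (List; []; _∷_; length)
  open import Data.List.Membership.Propositional using (_∈_; find)
  open import Data.List.Relation.Unary.Any using (here; there)
  open import Data.List.Relation.Unary.All using (all?; lookup)
  open import Data.List.Relation.Unary.All.Properties using (¬All⇒Any¬)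
  open import Data.Product using (∃)
  open import Data.Sum using (_⊎_; inj₁; inj₂)
  open import Relation.Nullary using (¬_; yes; no; contradiction)
  open import Relation.Nullary.Decidable using (_→-dec_)
  open import Relation.Unary using (Pred; Decidable; _⊆_)
  open import Relation.Binary.PropositionalEquality using (refl)

  module _ {A : Set} where

    count : ∀ {P : Pred A 0ℓ} → Decidable P → List A → ℕ
    count P? [] = 0
    count P? (u ∷ us) with P? u
    ... | yes _ = suc (count P? us)
    ... | no  _ = count P? us

    module _ {P Q : Pred A 0ℓ} (P? : Decidable P) (Q? : Decidable Q) (P⊆Q : P ⊆ Q) where

      count-mono : ∀ us → count P? us ≤ count Q? us
      count-mono [] = z≤n
      count-mono (u ∷ us) with P? u | Q? u
      ... | yes _ | yes _ = s≤s (count-mono us)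
      ... | no  _ | yes _ = m≤n⇒m≤1+n (count-mono us)
      ... | no  _ | no  _ = count-mono us
      ... | yes p | no ¬q = contradiction (P⊆Q p) ¬q

      count-strict : ∀ {u} us → u ∈ us → ¬ P u → Q u → count P? us < count Q? us
      count-strict (u ∷ us) (here refl) ¬p q with P? u | Q? u
      ... | yes p | _     = contradiction p ¬p
      ... | no  _ | yes _ = s≤s (count-mono us)
      ... | no  _ | no ¬q = contradiction q ¬q
      count-strict (v ∷ us) (there u∈us) ¬p q with P? v | Q? v
      ... | yes _ | yes _ = s≤s (count-strict us u∈us ¬p q)
      ... | no  _ | yes _ = m≤n⇒m≤1+n (count-strict us u∈us ¬p q)
      ... | no  _ | no  _ = count-strict us u∈us ¬p q
      ... | yes p | no ¬q = contradiction (P⊆Q p) ¬q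

    count≤length : ∀ {P : Pred A 0ℓ} (P? : Decidable P) us → count P? us ≤ length us
    count≤length P? [] = z≤n
    count≤length P? (u ∷ us) with P? u
    ... | yes _ = s≤s (count≤length P? us)
    ... | no  _ = m≤n⇒m≤1+n (count≤length P? us)

  -- Kleene iteration from the empty predicate: the approximants increase, and every step that
  -- does not stabilise adds an element of enum, so they are stable after length enum steps.
  module Finite {U : Set} (enum : List U) (enum-complete : ∀ u → u ∈ enum)
    (Φ : Pred U 0ℓ → Pred U 0ℓ)
    (Φ-mono : ∀ {P Q} → P ⊆ Q → Φ P ⊆ Φ Q)
    (Φ-dec : ∀ {P} → Decidable P → Decidable (Φ P)) where

    Approx : ℕ → Pred U 0ℓ
    Approx zero    _ = Empty
    Approx (suc k)   = Φ (Approx k)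

    approx? : ∀ k → Decidable (Approx k)
    approx? zero    _ = no λ ()
    approx? (suc k)   = Φ-dec (approx? k)

    Approx-chain : ∀ k → Approx k ⊆ Approx (suc k)
    Approx-chain zero    ()
    Approx-chain (suc k) = Φ-mono (Approx-chain k)

    Stable : ℕ → Set
    Stable k = Approx (suc k) ⊆ Approx k

    stable? : ∀ k → Stable k ⊎ (∃ λ u → u ∈ enum × Approx (suc k) u × ¬ Approx k u)
    stable? k with all? (λ u → approx? (suc k) u →-dec approx? k u) enum
    ... | yes all = inj₁ λ {u} → lookup all (enum-complete u)
    ... | no ¬all with find (¬All⇒Any¬ (λ u → approx? (suc k) u →-dec approx? k u) enum ¬all)
    ...   | u , u∈enum , ¬imp with approx? (suc k) u
    ...     | yes p = inj₂ (u , u∈enum , p , λ q → ¬imp λ _ → q)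
    ...     | no ¬p = contradiction (λ p → contradiction p ¬p) ¬imp

    progress : ∀ k → Stable k ⊎ k ≤ count (approx? k) enum
    progress zero = inj₂ z≤n
    progress (suc k) with stable? k
    ... | inj₁ stable = inj₁ (Φ-mono stable)
    ... | inj₂ (u , u∈enum , new , ¬old) with progress k
    ...   | inj₁ stable = contradiction (stable new) ¬old
    ...   | inj₂ k≤count = inj₂ (≤-trans (s≤s k≤count) grows)
      where
      grows : count (approx? k) enum < count (approx? (suc k)) enum
      grows = count-strict (approx? k) (approx? (suc k)) (Approx-chain k) enum u∈enum ¬old new

    -- Clients only need the four properties below, and unfolding the iteration makes type
    -- checking of its users prohibitively slow.
    abstract
      μ : Pred U 0ℓ
      μ = Approx (suc (length enum))

      μ? : Decidable μ
      μ? = approx? (suc (length enum))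

      μ-closed : Φ μ ⊆ μ
      μ-closed with progress (suc (length enum))
      ... | inj₁ stable = stable
      ... | inj₂ tooBig =
        contradiction (≤-trans tooBig (count≤length (approx? (suc (length enum))) enum)) 1+n≰n

      μ-least : ∀ {P} → Φ P ⊆ P → μ ⊆ P
      μ-least {P} ΦP⊆P = below (suc (length enum))
        where
        below : ∀ k → Approx k ⊆ P
        below (suc k) p = ΦP⊆P (Φ-mono (below k) p)

module FormulaEquality where
  open import Data.Nat using () renaming (_≟_ to _≟ℕ_)
  open import Relation.Nullary using (yes; no)
  open import Relation.Nullary.Decidable using (map′; _×-dec_)
  open import Relation.Binary.Definitions using (DecidableEquality)
  open import Relation.Binary.PropositionalEquality using (refl; cong; cong₂)

  infix 4 _≟_
  _≟_ : DecidableEquality Fm₀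
  var x    ≟ var y    = map′ (cong var) (λ { refl → refl }) (x ≟ℕ y)
  ⊥'       ≟ ⊥'       = yes refl
  (a ⇒ b)  ≟ (c ⇒ d)  = map′ (λ (p , q) → cong₂ _⇒_ p q) (λ { refl → refl , refl }) (a ≟ c ×-dec b ≟ d)
  (a ∨' b) ≟ (c ∨' d) = map′ (λ (p , q) → cong₂ _∨'_ p q) (λ { refl → refl , refl }) (a ≟ c ×-dec b ≟ d)
  (a ∧' b) ≟ (c ∧' d) = map′ (λ (p , q) → cong₂ _∧'_ p q) (λ { refl → refl , refl }) (a ≟ c ×-dec b ≟ d)
  var _    ≟ ⊥'       = no λ ()
  var _    ≟ (_ ⇒ _)  = no λ ()
  var _    ≟ (_ ∨' _) = no λ ()
  var _    ≟ (_ ∧' _) = no λ ()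
  ⊥'       ≟ var _    = no λ ()
  ⊥'       ≟ (_ ⇒ _)  = no λ ()
  ⊥'       ≟ (_ ∨' _) = no λ ()
  ⊥'       ≟ (_ ∧' _) = no λ ()
  (_ ⇒ _)  ≟ var _    = no λ ()
  (_ ⇒ _)  ≟ ⊥'       = no λ ()
  (_ ⇒ _)  ≟ (_ ∨' _) = no λ ()
  (_ ⇒ _)  ≟ (_ ∧' _) = no λ ()
  (_ ∨' _) ≟ var _    = no λ ()
  (_ ∨' _) ≟ ⊥'       = no λ ()
  (_ ∨' _) ≟ (_ ⇒ _)  = no λ ()
  (_ ∨' _) ≟ (_ ∧' _) = no λ ()
  (_ ∧' _) ≟ var _    = no λ ()
  (_ ∧' _) ≟ ⊥'       = no λ ()
  (_ ∧' _) ≟ (_ ⇒ _)  = no λ ()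
  (_ ∧' _) ≟ (_ ∨' _) = no λ ()

module Enumeration where
  open import Data.Nat using (zero; suc)
  open import Data.Fin.Subset using (Subset; inside; outside)
  open import Data.List using (List; []; _∷_; map; _++_)
  open import Data.List.Membership.Propositional using (_∈_)
  open import Data.List.Membership.Propositional.Properties using (∈-map⁺; ∈-++⁺ˡ; ∈-++⁺ʳ)
  open import Data.List.Relation.Unary.Any using (here)
  open import Data.Vec using ([]; _∷_)
  open import Relation.Binary.PropositionalEquality using (refl)

  subsets : ∀ n → List (Subset n)
  subsets zero    = [] ∷ []
  subsets (suc n) = map (inside ∷_) (subsets n) ++ map (outside ∷_) (subsets n)

  ∈-subsets : ∀ {n} (p : Subset n) → p ∈ subsets n
  ∈-subsets []            = here refl
  ∈-subsets (inside ∷ p)  = ∈-++⁺ˡ (∈-map⁺ (inside ∷_) (∈-subsets p))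
  ∈-subsets (outside ∷ p) = ∈-++⁺ʳ _ (∈-map⁺ (outside ∷_) (∈-subsets p))

ClosedUnder : ∀ {n} → (Fin n → Fm₀) → (Fm₀ → Fm₀ → Fm₀) → Set
ClosedUnder {n} S _∙_ = ∀ {i b c} → S i ≡ b ∙ c → ∃₂ λ (j k : Fin n) → S j ≡ b × S k ≡ c

module Canonical {n : ℕ} (S : Fin n → Fm₀)
  (⇒-closed : ClosedUnder S _⇒_) (∨-closed : ClosedUnder S _∨'_) (∧-closed : ClosedUnder S _∧'_) where

  open import Data.Fin.Properties using (any?)
  open import Data.Fin.Subset using (Subset; _∈_; _∉_; _⊆_; _∪_; ⁅_⁆) renaming (⊥ to ∅ˢ)
  open import Data.Fin.Subset.Properties
    using (_∈?_; _⊆?_; anySubset?; x∈p∪q⁻; x∈p∪q⁺; x∈⁅x⁆; x∈⁅y⁆⇒x≡y; ∉⊥; ⊆-refl; ⊆-trans)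
  open import Data.List using ([]; _∷_; allFin; cartesianProduct)
  open import Data.List.Membership.Propositional.Properties using (∈-allFin; ∈-cartesianProduct⁺)
  open import Data.List.Relation.Unary.All using (All; []; _∷_; lookup)
  open import Data.Product using (∃)
  open import Data.Sum using (_⊎_; inj₁; inj₂)
  open import Function using (_∘_)
  open import Relation.Nullary using (Dec; yes; no; ¬_; contradiction)
  open import Relation.Nullary.Decidable using (_×-dec_; _⊎-dec_)
  open import Relation.Unary using (Pred; Decidable)
  open import Relation.Binary.PropositionalEquality using (refl; sym; trans; cong; subst)

  open Derivations
  open KripkeSemantics
  open FormulaEquality
  open Enumeration

  Sequent : Set
  Sequent = Subset n × Fin n

  insert : Fin n → Subset n → Subset n
  insert a Γ = ⁅ a ⁆ ∪ Γ

  ∈-insert : ∀ a Γ → a ∈ insert a Γ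
  ∈-insert a Γ = x∈p∪q⁺ (inj₁ (x∈⁅x⁆ a))

  ⊆-insert : ∀ {a Γ} → Γ ⊆ insert a Γ
  ⊆-insert = x∈p∪q⁺ ∘ inj₂

  insert-mono : ∀ {a Γ Δ} → Γ ⊆ Δ → insert a Γ ⊆ insert a Δ
  insert-mono {a} {Γ} Γ⊆Δ j∈ with x∈p∪q⁻ ⁅ a ⁆ Γ j∈
  ... | inj₁ j∈a = x∈p∪q⁺ (inj₁ j∈a)
  ... | inj₂ j∈Γ = x∈p∪q⁺ (inj₂ (Γ⊆Δ j∈Γ))

  -- Natural deduction restricted to the formulas S i, with cut and weakening as explicit rules;
  -- a sequent (Γ , i) stands for the hypotheses {S j | j ∈ Γ} and the conclusion S i.
  Rule : Pred Sequent 0ℓ → Pred Sequent 0ℓ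
  Rule P (Γ , i) =
      (∃ λ j → S j ≡ S i × j ∈ Γ)
    ⊎ (∃ λ j → S j ≡ ⊥' × P (Γ , j))
    ⊎ (∃₂ λ j k → S i ≡ S j ∧' S k × P (Γ , j) × P (Γ , k))
    ⊎ (∃₂ λ j k → S j ≡ S i ∧' S k × P (Γ , j))
    ⊎ (∃₂ λ j k → S j ≡ S k ∧' S i × P (Γ , j))
    ⊎ (∃₂ λ j k → S i ≡ S j ∨' S k × P (Γ , j))
    ⊎ (∃₂ λ j k → S i ≡ S k ∨' S j × P (Γ , j))
    ⊎ (∃₂ λ d a → ∃ λ b → S d ≡ S a ∨' S b × P (Γ , d) × P (insert a Γ , i) × P (insert b Γ , i))
    ⊎ (∃₂ λ a b → S i ≡ S a ⇒ S b × P (insert a Γ , b))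
    ⊎ (∃₂ λ d a → S d ≡ S a ⇒ S i × P (Γ , d) × P (Γ , a))
    ⊎ (∃ λ a → P (Γ , a) × P (insert a Γ , i))
    ⊎ (∃ λ Γ′ → Γ′ ⊆ Γ × P (Γ′ , i))

  pattern hypᴿ j e j∈Γ         = inj₁ (j , e , j∈Γ)
  pattern ⊥-elimᴿ j e p        = inj₂ (inj₁ (j , e , p))
  pattern ∧-introᴿ j k e p q   = inj₂ (inj₂ (inj₁ (j , k , e , p , q)))
  pattern ∧-elim₁ᴿ j k e p     = inj₂ (inj₂ (inj₂ (inj₁ (j , k , e , p))))
  pattern ∧-elim₂ᴿ j k e p     = inj₂ (inj₂ (inj₂ (inj₂ (inj₁ (j , k , e , p)))))
  pattern ∨-intro₁ᴿ j k e p    = inj₂ (inj₂ (inj₂ (inj₂ (inj₂ (inj₁ (j , k , e , p))))))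
  pattern ∨-intro₂ᴿ j k e p    = inj₂ (inj₂ (inj₂ (inj₂ (inj₂ (inj₂ (inj₁ (j , k , e , p)))))))
  pattern ∨-elimᴿ d a b e p q r = inj₂ (inj₂ (inj₂ (inj₂ (inj₂ (inj₂ (inj₂ (inj₁ (d , a , b , e , p , q , r))))))))
  pattern ⇒-introᴿ a b e p     = inj₂ (inj₂ (inj₂ (inj₂ (inj₂ (inj₂ (inj₂ (inj₂ (inj₁ (a , b , e , p)))))))))
  pattern ⇒-elimᴿ d a e p q    = inj₂ (inj₂ (inj₂ (inj₂ (inj₂ (inj₂ (inj₂ (inj₂ (inj₂ (inj₁ (d , a , e , p , q))))))))))
  pattern cutᴿ a p q           = inj₂ (inj₂ (inj₂ (inj₂ (inj₂ (inj₂ (inj₂ (inj₂ (inj₂ (inj₂ (inj₁ (a , p , q)))))))))))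
  pattern weakenᴿ Γ′ s p       = inj₂ (inj₂ (inj₂ (inj₂ (inj₂ (inj₂ (inj₂ (inj₂ (inj₂ (inj₂ (inj₂ (Γ′ , s , p)))))))))))

  rule-mono : ∀ {P Q : Pred Sequent 0ℓ} → (∀ {s} → P s → Q s) → ∀ {s} → Rule P s → Rule Q s
  rule-mono f (hypᴿ j e j∈Γ)          = hypᴿ j e j∈Γ
  rule-mono f (⊥-elimᴿ j e p)         = ⊥-elimᴿ j e (f p)
  rule-mono f (∧-introᴿ j k e p q)    = ∧-introᴿ j k e (f p) (f q)
  rule-mono f (∧-elim₁ᴿ j k e p)      = ∧-elim₁ᴿ j k e (f p)
  rule-mono f (∧-elim₂ᴿ j k e p)      = ∧-elim₂ᴿ j k e (f p)
  rule-mono f (∨-intro₁ᴿ j k e p)     = ∨-intro₁ᴿ j k e (f p)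
  rule-mono f (∨-intro₂ᴿ j k e p)     = ∨-intro₂ᴿ j k e (f p)
  rule-mono f (∨-elimᴿ d a b e p q r) = ∨-elimᴿ d a b e (f p) (f q) (f r)
  rule-mono f (⇒-introᴿ a b e p)      = ⇒-introᴿ a b e (f p)
  rule-mono f (⇒-elimᴿ d a e p q)     = ⇒-elimᴿ d a e (f p) (f q)
  rule-mono f (cutᴿ a p q)            = cutᴿ a (f p) (f q)
  rule-mono f (weakenᴿ Γ′ s p)        = weakenᴿ Γ′ s (f p)

  rule? : ∀ {P : Pred Sequent 0ℓ} → Decidable P → Decidable (Rule P)
  rule? P? (Γ , i) =
        any? (λ j → S j ≟ S i ×-dec j ∈? Γ)
    ⊎-dec any? (λ j → S j ≟ ⊥' ×-dec P? (Γ , j))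
    ⊎-dec any? (λ j → any? λ k → S i ≟ S j ∧' S k ×-dec P? (Γ , j) ×-dec P? (Γ , k))
    ⊎-dec any? (λ j → any? λ k → S j ≟ S i ∧' S k ×-dec P? (Γ , j))
    ⊎-dec any? (λ j → any? λ k → S j ≟ S k ∧' S i ×-dec P? (Γ , j))
    ⊎-dec any? (λ j → any? λ k → S i ≟ S j ∨' S k ×-dec P? (Γ , j))
    ⊎-dec any? (λ j → any? λ k → S i ≟ S k ∨' S j ×-dec P? (Γ , j))
    ⊎-dec any? (λ d → any? λ a → any? λ b →
            S d ≟ S a ∨' S b ×-dec P? (Γ , d) ×-dec P? (insert a Γ , i) ×-dec P? (insert b Γ , i))
    ⊎-dec any? (λ a → any? λ b → S i ≟ S a ⇒ S b ×-dec P? (insert a Γ , b))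
    ⊎-dec any? (λ d → any? λ a → S d ≟ S a ⇒ S i ×-dec P? (Γ , d) ×-dec P? (Γ , a))
    ⊎-dec any? (λ a → P? (Γ , a) ×-dec P? (insert a Γ , i))
    ⊎-dec anySubset? (λ Γ′ → Γ′ ⊆? Γ ×-dec P? (Γ′ , i))

  open FixedPoint.Finite
    (cartesianProduct (subsets n) (allFin n))
    (λ (Γ , i) → ∈-cartesianProduct⁺ (∈-subsets Γ) (∈-allFin i))
    Rule rule-mono rule?
    using (μ; μ?; μ-closed; μ-least)

  D : Subset n → Fin n → Set
  D Γ i = μ (Γ , i)

  D? : ∀ Γ i → Dec (D Γ i)
  D? Γ i = μ? (Γ , i)

  derive : ∀ {s} → Rule μ s → μ s
  derive = μ-closed

  D-hyp : ∀ {Γ i} → i ∈ Γ → D Γ i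
  D-hyp {i = i} i∈Γ = derive (hypᴿ i refl i∈Γ)

  D-weaken : ∀ {Γ Δ i} → Γ ⊆ Δ → D Γ i → D Δ i
  D-weaken {Γ} Γ⊆Δ p = derive (weakenᴿ Γ Γ⊆Δ p)

  ctx : Subset n → Hyps
  ctx Γ A = ∃ λ j → j ∈ Γ × S j ≡ A

  ctx-insert : ∀ {a Γ A} → ctx (insert a Γ) A → (ctx Γ ▸ S a) A
  ctx-insert {a} {Γ} (j , j∈ , refl) with x∈p∪q⁻ ⁅ a ⁆ Γ j∈
  ... | inj₁ j∈a = inj₁ (cong S (x∈⁅y⁆⇒x≡y a j∈a))
  ... | inj₂ j∈Γ = inj₂ (j , j∈Γ , refl)

  ctx-mono : ∀ {Γ Δ A} → Γ ⊆ Δ → ctx Γ A → ctx Δ A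
  ctx-mono Γ⊆Δ (j , j∈Γ , e) = j , Γ⊆Δ j∈Γ , e

  Sound : Pred Sequent 0ℓ
  Sound (Γ , i) = ctx Γ ⊢ S i

  rule-sound : ∀ {s} → Rule Sound s → Sound s
  rule-sound {Γ , _} (hypᴿ j e j∈Γ)          = hyp (_ , j∈Γ , e)
  rule-sound {Γ , _} (⊥-elimᴿ j e p)         = by ax-⊥E (subst (ctx Γ ⊢_) e p)
  rule-sound {Γ , _} (∧-introᴿ j k e p q)    = subst (ctx Γ ⊢_) (sym e) (∧-intro p q)
  rule-sound {Γ , _} (∧-elim₁ᴿ j k e p)      = by ax-∧E₁ (subst (ctx Γ ⊢_) e p)
  rule-sound {Γ , _} (∧-elim₂ᴿ j k e p)      = by ax-∧E₂ (subst (ctx Γ ⊢_) e p)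
  rule-sound {Γ , _} (∨-intro₁ᴿ j k e p)     = subst (ctx Γ ⊢_) (sym e) (by ax-∨I₁ p)
  rule-sound {Γ , _} (∨-intro₂ᴿ j k e p)     = subst (ctx Γ ⊢_) (sym e) (by ax-∨I₂ p)
  rule-sound {Γ , _} (∨-elimᴿ d a b e p q r) =
    ∨-elim (subst (ctx Γ ⊢_) e p) (weaken ctx-insert q) (weaken ctx-insert r)
  rule-sound {Γ , _} (⇒-introᴿ a b e p)      = subst (ctx Γ ⊢_) (sym e) (deduction (weaken ctx-insert p))
  rule-sound {Γ , _} (⇒-elimᴿ d a e p q)     = mp (subst (ctx Γ ⊢_) e p) q
  rule-sound {Γ , _} (cutᴿ a p q)            = cut p (weaken ctx-insert q)
  rule-sound {Γ , _} (weakenᴿ Γ′ s p)        = weaken (ctx-mono s) p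

  D-sound : ∀ {Γ i} → D Γ i → ctx Γ ⊢ S i
  D-sound = μ-least rule-sound

  record IsWorld (Δ : Subset n) : Set where
    field
      deductively-closed : ∀ {i} → D Δ i → i ∈ Δ
      consistent         : ∀ {i} → S i ≡ ⊥' → i ∉ Δ
      prime              : ∀ {d a b} → S d ≡ S a ∨' S b → d ∈ Δ → a ∈ Δ ⊎ b ∈ Δ

  MaximalAvoiding : Fin n → Subset n → Set
  MaximalAvoiding k Δ = ¬ D Δ k × (∀ c → c ∈ Δ ⊎ D (insert c Δ) k)

  maximal-avoiding⇒world : ∀ {k Δ} → MaximalAvoiding k Δ → IsWorld Δ
  maximal-avoiding⇒world {k} {Δ} (¬Dk , maximal) = record
    { deductively-closed = closedΔ ; consistent = consistent ; prime = prime }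
    where
    closedΔ : ∀ {i} → D Δ i → i ∈ Δ
    closedΔ {i} Di with maximal i
    ... | inj₁ i∈Δ = i∈Δ
    ... | inj₂ Dk  = contradiction (derive (cutᴿ i Di Dk)) ¬Dk
    consistent : ∀ {i} → S i ≡ ⊥' → i ∉ Δ
    consistent e i∈Δ = ¬Dk (derive (⊥-elimᴿ _ e (D-hyp i∈Δ)))
    prime : ∀ {d a b} → S d ≡ S a ∨' S b → d ∈ Δ → a ∈ Δ ⊎ b ∈ Δ
    prime {d} {a} {b} e d∈Δ with maximal a | maximal b
    ... | inj₁ a∈Δ | _        = inj₁ a∈Δ
    ... | inj₂ _   | inj₁ b∈Δ = inj₂ b∈Δ
    ... | inj₂ Da  | inj₂ Db  = contradiction (derive (∨-elimᴿ d a b e (D-hyp d∈Δ) Da Db)) ¬Dk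

  saturate : ∀ {k} cs Γ → ¬ D Γ k →
             ∃ λ Δ → Γ ⊆ Δ × ¬ D Δ k × All (λ c → c ∈ Δ ⊎ D (insert c Δ) k) cs
  saturate []       Γ ¬Dk = Γ , ⊆-refl , ¬Dk , []
  saturate {k} (c ∷ cs) Γ ¬Dk with D? (insert c Γ) k
  ... | yes Dk′ =
    let Δ , Γ⊆Δ , ¬DΔk , maximal = saturate cs Γ ¬Dk
    in  Δ , Γ⊆Δ , ¬DΔk , inj₂ (D-weaken (insert-mono Γ⊆Δ) Dk′) ∷ maximal
  ... | no ¬Dk′ =
    let Δ , Γ′⊆Δ , ¬DΔk , maximal = saturate cs (insert c Γ) ¬Dk′
    in  Δ , ⊆-trans ⊆-insert Γ′⊆Δ , ¬DΔk , inj₁ (Γ′⊆Δ (∈-insert c Γ)) ∷ maximal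

  extend : ∀ {Γ k} → ¬ D Γ k → ∃ λ Δ → IsWorld Δ × Γ ⊆ Δ × ¬ D Δ k
  extend {Γ} ¬Dk =
    let Δ , Γ⊆Δ , ¬DΔk , maximal = saturate (allFin n) Γ ¬Dk
    in  Δ , maximal-avoiding⇒world (¬DΔk , λ c → lookup maximal (∈-allFin c)) , Γ⊆Δ , ¬DΔk

  World : Set
  World = ∃ IsWorld

  canonical : KripkeModel
  canonical = record
    { World    = World
    ; _≼_      = λ (Γ , _) (Δ , _) → Γ ⊆ Δ
    ; ≼-refl   = ⊆-refl
    ; ≼-trans  = λ p q → ⊆-trans p q
    ; Val      = λ (Γ , _) x → ∃ λ j → S j ≡ var x × j ∈ Γ
    ; Val-mono = λ { Γ⊆Δ (j , e , j∈Γ) → j , e , Γ⊆Δ j∈Γ } }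

  split : ∀ {_∙_ : Fm₀ → Fm₀ → Fm₀} → ClosedUnder S _∙_ → ∀ {i b c} → S i ≡ b ∙ c →
          ∃₂ λ j k → S j ≡ b × S k ≡ c × S i ≡ S j ∙ S k
  split closedUnder e with closedUnder e
  ... | j , k , refl , refl = j , k , refl , refl , e

  open IsWorld
  open Forcing canonical

  ∈-by-rule : ∀ {Γ i} → IsWorld Γ → Rule μ (Γ , i) → i ∈ Γ
  ∈-by-rule w r = deductively-closed w (derive r)

  forces⇒∈ : ∀ a {Γ} (w : IsWorld Γ) {i} → S i ≡ a → (Γ , w) ⊩ a → i ∈ Γ
  ∈⇒forces : ∀ a {Γ} (w : IsWorld Γ) {i} → S i ≡ a → i ∈ Γ → (Γ , w) ⊩ a
  forces⇒∈ (var x) w e (j , e′ , j∈Γ) = ∈-by-rule w (hypᴿ j (trans e′ (sym e)) j∈Γ)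
  forces⇒∈ (b ∧' c) w e (p , q) with split ∧-closed e
  ... | j , k , ej , ek , e′ =
    ∈-by-rule w (∧-introᴿ j k e′ (D-hyp (forces⇒∈ b w ej p)) (D-hyp (forces⇒∈ c w ek q)))
  forces⇒∈ (b ∨' c) w e p with split ∨-closed e | p
  ... | j , k , ej , ek , e′ | inj₁ p = ∈-by-rule w (∨-intro₁ᴿ j k e′ (D-hyp (forces⇒∈ b w ej p)))
  ... | j , k , ej , ek , e′ | inj₂ q = ∈-by-rule w (∨-intro₂ᴿ k j e′ (D-hyp (forces⇒∈ c w ek q)))
  forces⇒∈ (b ⇒ c) {Γ} w {i} e f with split ⇒-closed e | i ∈? Γ
  ... | _ | yes i∈Γ = i∈Γ
  ... | j , k , ej , ek , e′ | no i∉Γ =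
    let Δ , wΔ , Γ,j⊆Δ , ¬DΔk =
          extend {insert j Γ} {k} λ Dk → i∉Γ (∈-by-rule w (⇒-introᴿ j k e′ Dk))
        Δ⊩b = ∈⇒forces b wΔ ej (Γ,j⊆Δ (∈-insert j Γ))
    in  contradiction (D-hyp (forces⇒∈ c wΔ ek (f (Δ , wΔ) (⊆-trans ⊆-insert Γ,j⊆Δ) Δ⊩b))) ¬DΔk
  ∈⇒forces (var x) w e i∈Γ = _ , e , i∈Γ
  ∈⇒forces ⊥' w e i∈Γ = contradiction i∈Γ (consistent w e)
  ∈⇒forces (b ∧' c) w {i} e i∈Γ with split ∧-closed e
  ... | j , k , ej , ek , e′ =
    ∈⇒forces b w ej (∈-by-rule w (∧-elim₁ᴿ i k e′ (D-hyp i∈Γ))) ,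
    ∈⇒forces c w ek (∈-by-rule w (∧-elim₂ᴿ i j e′ (D-hyp i∈Γ)))
  ∈⇒forces (b ∨' c) w e i∈Γ with split ∨-closed e
  ... | j , k , ej , ek , e′ with prime w e′ i∈Γ
  ...   | inj₁ j∈Γ = inj₁ (∈⇒forces b w ej j∈Γ)
  ...   | inj₂ k∈Γ = inj₂ (∈⇒forces c w ek k∈Γ)
  ∈⇒forces (b ⇒ c) w {i} e i∈Γ (Δ , wΔ) Γ⊆Δ p with split ⇒-closed e
  ... | j , k , ej , ek , e′ =
    ∈⇒forces c wΔ ek
      (∈-by-rule wΔ (⇒-elimᴿ i j e′ (D-hyp (Γ⊆Δ i∈Γ)) (D-hyp (forces⇒∈ b wΔ ej p))))

  decide : ∀ i → ⊢IPC (S i) ⊎ CounterModel (S i)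
  decide i with D? ∅ˢ i
  ... | yes Di = inj₁ (∅⊢⇒⊢IPC (weaken (λ (_ , j∈∅ , _) → ∉⊥ j∈∅) (D-sound Di)))
  ... | no ¬Di =
    let Δ , w , _ , ¬DΔi = extend ¬Di
    in  inj₂ (canonical , (Δ , w) , λ Δ⊩ → ¬DΔi (D-hyp (forces⇒∈ (S i) w refl Δ⊩)))

module Decidability where

  open Derivations
  open KripkeSemantics

  open import Data.List using (List; []; _∷_; _++_; lookup)
  open import Data.List.Membership.Propositional using (_∈_)
  open import Data.List.Membership.Propositional.Properties using (∈-lookup; ∈-++⁺ˡ; ∈-++⁺ʳ; ∈-++⁻)
  open import Data.List.Relation.Unary.Any using (here; there; index)
  open import Data.List.Relation.Unary.Any.Properties using (lookup-index)
  open import Data.Sum using (_⊎_; inj₁; inj₂)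
  open import Relation.Nullary using (Dec; yes; no; contradiction)
  open import Relation.Binary.PropositionalEquality using (refl; sym; subst)

  subformulas : Fm₀ → List Fm₀
  subformulas (var x)  = var x ∷ []
  subformulas ⊥'       = ⊥' ∷ []
  subformulas (a ⇒ b)  = (a ⇒ b) ∷ subformulas a ++ subformulas b
  subformulas (a ∨' b) = a ∨' b ∷ subformulas a ++ subformulas b
  subformulas (a ∧' b) = a ∧' b ∷ subformulas a ++ subformulas b

  ∈-subformulas : ∀ a → a ∈ subformulas a
  ∈-subformulas (var x)  = here refl
  ∈-subformulas ⊥'       = here refl
  ∈-subformulas (a ⇒ b)  = here refl
  ∈-subformulas (a ∨' b) = here refl
  ∈-subformulas (a ∧' b) = here refl

  subformulas-trans : ∀ a {b c} → b ∈ subformulas a → c ∈ subformulas b → c ∈ subformulas a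
  subformulas-++-trans : ∀ a b {x y} → x ∈ subformulas a ++ subformulas b → y ∈ subformulas x →
             y ∈ subformulas a ++ subformulas b
  subformulas-trans (var _)  (here refl) c∈ = c∈
  subformulas-trans ⊥'       (here refl) c∈ = c∈
  subformulas-trans (_ ⇒ _)  (here refl) c∈ = c∈
  subformulas-trans (_ ∨' _) (here refl) c∈ = c∈
  subformulas-trans (_ ∧' _) (here refl) c∈ = c∈
  subformulas-trans (a ⇒ b)  (there b∈) c∈ = there (subformulas-++-trans a b b∈ c∈)
  subformulas-trans (a ∨' b) (there b∈) c∈ = there (subformulas-++-trans a b b∈ c∈)
  subformulas-trans (a ∧' b) (there b∈) c∈ = there (subformulas-++-trans a b b∈ c∈)
  subformulas-++-trans a b x∈ y∈ with ∈-++⁻ (subformulas a) x∈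
  ... | inj₁ x∈a = ∈-++⁺ˡ (subformulas-trans a x∈a y∈)
  ... | inj₂ x∈b = ∈-++⁺ʳ (subformulas a) (subformulas-trans b x∈b y∈)

  subformulas-closed : ∀ {_∙_ : Fm₀ → Fm₀ → Fm₀} →
                       (∀ {b c} → subformulas (b ∙ c) ≡ b ∙ c ∷ subformulas b ++ subformulas c) →
                       ∀ a {b c} → b ∙ c ∈ subformulas a → b ∈ subformulas a × c ∈ subformulas a
  subformulas-closed {_∙_} unfold a {b} {c} b∙c∈ =
    subformulas-trans a b∙c∈ (subst (b ∈_) (sym unfold) (there (∈-++⁺ˡ (∈-subformulas b)))) ,
    subformulas-trans a b∙c∈ (subst (c ∈_) (sym unfold) (there (∈-++⁺ʳ (subformulas b) (∈-subformulas c))))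

  lookup-closedUnder : ∀ {L _∙_} → (∀ {b c} → b ∙ c ∈ L → b ∈ L × c ∈ L) → ClosedUnder (lookup L) _∙_
  lookup-closedUnder {L} closed {i} e with closed (subst (_∈ L) e (∈-lookup i))
  ... | b∈L , c∈L = index b∈L , index c∈L , sym (lookup-index b∈L) , sym (lookup-index c∈L)

  decide : ∀ a → ⊢IPC a ⊎ CounterModel a
  decide a = subst (λ x → ⊢IPC x ⊎ CounterModel x) (sym (lookup-index a∈L)) (Canonical.decide
    (lookup L)
    (lookup-closedUnder (subformulas-closed {_⇒_} refl a))
    (lookup-closedUnder (subformulas-closed {_∨'_} refl a))
    (lookup-closedUnder (subformulas-closed {_∧'_} refl a))
    (index a∈L))
    where
    L = subformulas a
    a∈L = ∈-subformulas a

  provable? : ∀ a → Dec (⊢IPC a)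
  provable? a with decide a
  ... | inj₁ ⊢a = yes ⊢a
  ... | inj₂ c  = no (refute c)

  disjunction-property : ∀ {a b} → ⊢IPC (a ∨' b) → ⊢IPC a ⊎ ⊢IPC b
  disjunction-property {a} {b} ⊢a∨b with decide a | decide b
  ... | inj₁ ⊢a | _       = inj₁ ⊢a
  ... | inj₂ _  | inj₁ ⊢b = inj₂ ⊢b
  ... | inj₂ ca | inj₂ cb = contradiction ⊢a∨b (refute (countermodel-∨ {a} {b} ca cb))

module LindenbaumModel where

  open Derivations
  open KripkeSemantics
  open Decidability

  open import Data.Empty using (⊥-elim)
  open import Data.Unit using (⊤; tt)
  open import Data.Product using (proj₁)
  open import Data.Product.Function.NonDependent.Propositional using (_×-⇔_)
  open import Data.Sum using ([_,_]′)
  open import Function.Bundles using (mk⇔)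
  open import Function.Properties.Equivalence using () renaming (trans to ⇔-trans)
  open import Relation.Nullary using (Dec; yes; no; contradiction)
  open import Relation.Nullary.Decidable using (map′; _→-dec_; _×-dec_; _⊎-dec_)
  open import Relation.Binary.Lattice.Bundles using (HeytingAlgebra)
  open import Relation.Unary using (Pred; _⊆_)
  open import Relation.Binary.PropositionalEquality using (refl; sym; cong₂; subst)

  infix 4 _≤_ _≈_
  _≤_ : Fm₀ → Fm₀ → Set
  a ≤ b = ⊢IPC (a ⇒ b)

  _≈_ : Fm₀ → Fm₀ → Set
  a ≈ b = a ≤ b × b ≤ a

  ⊤' : Fm₀
  ⊤' = ⊥' ⇒ ⊥'

  ≤-trans : ∀ {a b c} → a ≤ b → b ≤ c → a ≤ c
  ≤-trans a≤b b≤c = deduction₀ (by b≤c (by a≤b assumption))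

  ≤-⊤ : ∀ {a} → a ≤ ⊤'
  ≤-⊤ = mp ax-K ⇒-refl

  ⊤-≤ : ∀ {a} → ⊢IPC a → ⊤' ≤ a
  ⊤-≤ ⊢a = mp ax-K ⊢a

  noncontradiction : ∀ {a} → a ∧' (a ⇒ ⊥') ≤ ⊥'
  noncontradiction = deduction₀ (mp (by ax-∧E₂ assumption) (by ax-∧E₁ assumption))

  provable⇔≈⊤ : ∀ {a} → ⊢IPC a ⇔ a ≈ ⊤'
  provable⇔≈⊤ = mk⇔ (λ ⊢a → ≤-⊤ , ⊤-≤ ⊢a) (λ (_ , ⊤≤a) → mp ⊤≤a ⇒-refl)

  ∧-provable⇔ : ∀ {a b} → (⊢IPC a × ⊢IPC b) ⇔ ⊢IPC (a ∧' b)
  ∧-provable⇔ = mk⇔ (λ (⊢a , ⊢b) → mp (mp ax-∧I ⊢a) ⊢b)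
                    (λ ⊢a∧b → mp ax-∧E₁ ⊢a∧b , mp ax-∧E₂ ⊢a∧b)

  Lindenbaum : HeytingAlgebra 0ℓ 0ℓ 0ℓ
  Lindenbaum = record
    { Carrier = Fm₀ ; _≈_ = _≈_ ; _≤_ = _≤_
    ; _∨_ = _∨'_ ; _∧_ = _∧'_ ; _⇨_ = _⇒_ ; ⊤ = ⊤' ; ⊥ = ⊥'
    ; isHeytingAlgebra = record
      { isBoundedLattice = record
        { isLattice = record
          { isPartialOrder = record
            { isPreorder = record
              { isEquivalence = record
                { refl  = ⇒-refl , ⇒-refl
                ; sym   = λ (p , q) → q , p
                ; trans = λ (p , q) (r , s) → ≤-trans p r , ≤-trans s q }
              ; reflexive = proj₁
              ; trans     = ≤-trans }
            ; antisym = _,_ }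
          ; supremum = λ _ _ → ax-∨I₁ , ax-∨I₂ , λ _ p q →
              deduction₀ (∨-elim assumption (by p assumption) (by q assumption))
          ; infimum  = λ _ _ → ax-∧E₁ , ax-∧E₂ , λ _ p q →
              deduction₀ (∧-intro (by p assumption) (by q assumption)) }
        ; maximum = λ _ → ≤-⊤
        ; minimum = λ _ → ax-⊥E }
      ; exponential = λ _ _ _ →
          (λ p → deduction₀ (deduction (by p (∧-intro (weaken₁ assumption) assumption)))) ,
          (λ p → deduction₀ (mp (by p (by ax-∧E₁ assumption)) (by ax-∧E₂ assumption))) } }

  point : KripkeModel
  point = record
    { World = ⊤ ; _≼_ = λ _ _ → ⊤ ; ≼-refl = tt ; ≼-trans = λ _ _ → tt
    ; Val = λ _ _ → ⊤ ; Val-mono = λ _ _ → tt }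

  Holds : Fm₀ → Set
  Holds = Forcing._⊩_ point tt

  holds? : ∀ a → Dec (Holds a)
  holds? (var x)  = yes tt
  holds? ⊥'       = no λ ()
  holds? (a ⇒ b)  = map′ (λ f _ _ → f) (λ f → f tt tt) (holds? a →-dec holds? b)
  holds? (a ∨' b) = holds? a ⊎-dec holds? b
  holds? (a ∧' b) = holds? a ×-dec holds? b

  holds-filter : IsFilter Lindenbaum Holds
  holds-filter = record
    { nonempty = ⊤' , λ _ _ p → p
    ; upward   = λ a a≤b → Forcing.sound point a≤b tt tt tt a
    ; ∧-closed = _,_
    ; proper   = λ () }

  holds-maximal : ∀ (G : Pred Fm₀ 0ℓ) → IsFilter Lindenbaum G → Holds ⊆ G → G ⊆ Holds
  holds-maximal G G-filter Holds⊆G {a} a∈G with holds? a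
  ... | yes a-holds = a-holds
  ... | no  a-fails =
    contradiction (upward (∧-closed a∈G (Holds⊆G {a ⇒ ⊥'} λ _ _ → a-fails)) noncontradiction) proper
    where open IsFilter G-filter

  holds-ultrafilter : IsUltrafilter Lindenbaum Holds
  holds-ultrafilter = record { isFilter = holds-filter ; maximal = holds-maximal }

  box : ∀ {a} → Dec (⊢IPC a) → Fm₀
  box (yes _) = ⊤'
  box (no _)  = ⊥'

  □-IPC : Fm₀ → Fm₀
  □-IPC a = box (provable? a)

  box-≤ : ∀ {a} (d : Dec (⊢IPC a)) → box d ≤ a
  box-≤ (yes ⊢a) = ⊤-≤ ⊢a
  box-≤ (no _)   = ax-⊥E

  box-⇒ : ∀ {a b c} (d₁ : Dec (a ≤ b)) (d₂ : Dec (b ≤ c)) (d₃ : Dec (a ≤ c)) →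
          box d₁ ≤ box d₂ ⇒ box d₃
  box-⇒ (no _)    _         _         = ax-⊥E
  box-⇒ (yes _)   (no _)    _         = ⊤-≤ ax-⊥E
  box-⇒ (yes _)   (yes _)   (yes _)   = ⊤-≤ ⇒-refl
  box-⇒ (yes a≤b) (yes b≤c) (no a≰c) = contradiction (≤-trans a≤b b≤c) a≰c

  box-∨ : ∀ {a b} (d : Dec (⊢IPC (a ∨' b))) (d₁ : Dec (⊢IPC a)) (d₂ : Dec (⊢IPC b)) →
          box d ≤ box d₁ ∨' box d₂
  box-∨ (no _)     _       _       = ax-⊥E
  box-∨ (yes _)    (yes _) _       = ax-∨I₁
  box-∨ (yes _)    (no _)  (yes _) = ax-∨I₂
  box-∨ (yes ⊢a∨b) (no ⊬a) (no ⊬b) = ⊥-elim ([ ⊬a , ⊬b ]′ (disjunction-property ⊢a∨b))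

  box-cong : ∀ {a b} → a ≈ b → (d₁ : Dec (⊢IPC a)) (d₂ : Dec (⊢IPC b)) → box d₁ ≈ box d₂
  box-cong _         (yes _)  (yes _)  = ⇒-refl , ⇒-refl
  box-cong _         (no _)   (no _)   = ⇒-refl , ⇒-refl
  box-cong (a≤b , _) (yes ⊢a) (no ⊬b)  = contradiction (mp a≤b ⊢a) ⊬b
  box-cong (_ , b≤a) (no ⊬a)  (yes ⊢b) = contradiction (mp b≤a ⊢b) ⊬a

  box-holds⇔ : ∀ {a} (d : Dec (⊢IPC a)) → Holds (box d) ⇔ ⊢IPC a
  box-holds⇔ (yes ⊢a) = mk⇔ (λ _ → ⊢a) (λ _ _ _ p → p)
  box-holds⇔ (no ⊬a)  = mk⇔ (λ ()) ⊬a

  𝓜-IPC : Model 0ℓ 0ℓ 0ℓ 0ℓ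
  𝓜-IPC = record
    { algebra       = Lindenbaum
    ; TRUE          = Holds
    ; isUltrafilter = holds-ultrafilter
    ; f□            = □-IPC
    ; f□-cong       = λ {a} {b} a≈b → box-cong a≈b (provable? a) (provable? b)
    ; ax1           = λ a → box-≤ (provable? a)
    ; ax2           = λ a b c → box-⇒ (provable? (a ⇒ b)) (provable? (b ⇒ c)) (provable? (a ⇒ c))
    ; ax3           = λ a b → box-∨ (provable? (a ∨' b)) (provable? a) (provable? b)
    ; ax4           = λ a → ⇔-trans (box-holds⇔ (provable? a)) provable⇔≈⊤ }

  ⟦⌜_⌝⟧ : ∀ φ → ⟦_⟧ 𝓜-IPC ⌜ φ ⌝ var ≡ φ
  ⟦⌜ var x ⌝⟧  = refl
  ⟦⌜ ⊥' ⌝⟧     = refl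
  ⟦⌜ φ ⇒ ψ ⌝⟧  = cong₂ _⇒_ ⟦⌜ φ ⌝⟧ ⟦⌜ ψ ⌝⟧
  ⟦⌜ φ ∨' ψ ⌝⟧ = cong₂ _∨'_ ⟦⌜ φ ⌝⟧ ⟦⌜ ψ ⌝⟧
  ⟦⌜ φ ∧' ψ ⌝⟧ = cong₂ _∧'_ ⟦⌜ φ ⌝⟧ ⟦⌜ ψ ⌝⟧

  ⊨-≡⇔provable : ∀ φ ψ → _⊨_ 𝓜-IPC var (⌜ φ ⌝ ≡' ⌜ ψ ⌝) ⇔ ⊢IPC (φ ⇔' ψ)
  ⊨-≡⇔provable φ ψ =
    subst (λ (a , b) → Holds (□-IPC (a ⇒ b) ∧' □-IPC (b ⇒ a)) ⇔ ⊢IPC (φ ⇔' ψ))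
          (cong₂ _,_ (sym ⟦⌜ φ ⌝⟧) (sym ⟦⌜ ψ ⌝⟧))
          (⇔-trans (box-holds⇔ (provable? (φ ⇒ ψ)) ×-⇔ box-holds⇔ (provable? (ψ ⇒ φ))) ∧-provable⇔)

open LindenbaumModel using (𝓜-IPC; ⊨-≡⇔provable)

corollary5p5 : Σ (Model 0ℓ 0ℓ 0ℓ 0ℓ) λ 𝓜 → Σ (Assignment 𝓜) λ ε →
                 ∀ (φ ψ : Fm₀) → (_⊨_ 𝓜 ε (⌜ φ ⌝ ≡' ⌜ ψ ⌝)) ⇔ (⊢IPC (φ ⇔' ψ))
corollary5p5 = 𝓜-IPC , var , ⊨-≡⇔provable
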